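{- Let $k\ge3$ be an odd integer and $p$ a prime with $p>k$. Then $\varphi_k^2(p)<p$.
   Context: For $k\in\mathbb{N}$, define $\varphi_k:\mathbb{N}\setminus\{1\}\to\mathbb{N}\setminus\{1\}$ by $\varphi_k(x)=x+k$ if $x$ is prime, and $\varphi_k(x)=$ the largest prime divisor of $x$ if $x$ is composite; $\varphi_k^2=\varphi_k\circ\varphi_k$. -}

module Defs where

open import Data.Nat using (ℕ; zero; suc; _+_; _*_)
open import Data.Nat.Divisibility using (_∣?_)
open import Data.Nat.Primality using (prime?)
open import Data.Product using (∃)
open import Relation.Binary.PropositionalEquality using (_≡_)
open import Relation.Nullary using (yes; no)
open import Relation.Nullary.Decidable using (_×-dec_)

Odd : ℕ → Set
Odd k = ∃ λ m → k ≡ 2 * m + 1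

-- largestPrimeDivisorFrom d x : the largest prime q ≤ d with q ∣ x
-- (returns 1 if there is none)
largestPrimeDivisorFrom : ℕ → ℕ → ℕ
largestPrimeDivisorFrom zero    x = 1
largestPrimeDivisorFrom (suc d) x with prime? (suc d) ×-dec (suc d ∣? x)
... | yes _ = suc d
... | no  _ = largestPrimeDivisorFrom d x

largestPrimeDivisor : ℕ → ℕ
largestPrimeDivisor x = largestPrimeDivisorFrom x x

-- φ_k(x) = x + k if x prime, largest prime divisor of x otherwise
-- (intended domain ℕ ∖ {1}; on x ≥ 2 non-prime means composite)
φ : ℕ → ℕ → ℕ
φ k x with prime? x
... | yes _ = x + k
... | no  _ = largestPrimeDivisor x

φ² : ℕ → ℕ → ℕ
φ² k x = φ k (φ k x)

-- For p > k both p and k are odd, so p + k is even and larger than 2, hence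
-- not prime: φ_k sends p to p + k and then to a prime divisor q of p + k.
-- As a prime divisor of a non-prime number, q is a proper divisor, so
-- 2q ≤ p + k < 2p.
module Submission where

open import Defs
open import Data.Nat using (ℕ; zero; suc; _+_; _*_; _/_; _%_; _≤_; _<_; s≤s; z≤n; NonZero; >-nonZero)
open import Data.Nat.Properties
open import Data.Nat.DivMod using (m≡m%n+[m/n]*n; m%n<n)
open import Data.Nat.Divisibility using (_∣_; _∣?_; divides; quotient; quotient>1; m∣n⇒n≡quotient*m; ∣⇒≤)
open import Data.Nat.Primality using (Prime; prime?; prime⇒irreducible)
open import Data.Nat.Tactic.RingSolver using (solve-∀)
open import Data.Product using (_,_)
open import Data.Sum using (inj₁; inj₂)
open import Relation.Binary.PropositionalEquality using (_≡_; _≢_; refl; sym; trans; cong; cong₂)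
open import Relation.Nullary using (¬_; yes; no; contradiction)
open import Relation.Nullary.Decidable using (_×-dec_)

φ-prime : ∀ k {x} → Prime x → φ k x ≡ x + k
φ-prime k {x} px with prime? x
... | yes _ = refl
... | no ¬px = contradiction px ¬px

φ-¬prime : ∀ k {x} → ¬ Prime x → φ k x ≡ largestPrimeDivisor x
φ-¬prime k {x} ¬px with prime? x
... | yes px = contradiction px ¬px
... | no _ = refl

-- The junk value 1 returned when no prime divisor is found must also be
-- below the bound, hence the hypothesis 1 < p.
largestPrimeDivisorFrom-< : ∀ {p} d x → 1 < p → (∀ {q} → Prime q → q ∣ x → q < p) →
                            largestPrimeDivisorFrom d x < p
largestPrimeDivisorFrom-< zero x 1<p bound = 1<p
largestPrimeDivisorFrom-< (suc d) x 1<p bound with prime? (suc d) ×-dec (suc d ∣? x)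
... | yes (pq , q∣x) = bound pq q∣x
... | no _ = largestPrimeDivisorFrom-< d x 1<p bound

prime∧2∣⇒≡2 : ∀ {p} → Prime p → 2 ∣ p → p ≡ 2
prime∧2∣⇒≡2 pp 2∣p with prime⇒irreducible pp 2∣p
... | inj₁ ()
... | inj₂ 2≡p = sym 2≡p

2∣∧2<⇒¬prime : ∀ {n} → 2 ∣ n → 2 < n → ¬ Prime n
2∣∧2<⇒¬prime 2∣n 2<n pn = <⇒≢ 2<n (sym (prime∧2∣⇒≡2 pn 2∣n))

prime∧2<⇒odd : ∀ {p} → Prime p → 2 < p → Odd p
prime∧2<⇒odd {p} pp 2<p with p % 2 | m%n<n p 2 | m≡m%n+[m/n]*n p 2
... | zero | _ | p≡[p/2]*2 = contradiction (prime∧2∣⇒≡2 pp (divides (p / 2) p≡[p/2]*2)) (>⇒≢ 2<p)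
... | suc zero | _ | p≡1+[p/2]*2 = p / 2 , trans p≡1+[p/2]*2 (reorder (p / 2))
  where
  reorder : ∀ a → 1 + a * 2 ≡ 2 * a + 1
  reorder = solve-∀
... | suc (suc _) | s≤s (s≤s ()) | _

odd+odd-even : ∀ {m n} → Odd m → Odd n → 2 ∣ m + n
odd+odd-even (a , m≡2a+1) (b , n≡2b+1) =
  divides (a + b + 1) (trans (cong₂ _+_ m≡2a+1 n≡2b+1) (pair a b))
  where
  pair : ∀ a b → 2 * a + 1 + (2 * b + 1) ≡ (a + b + 1) * 2
  pair = solve-∀

∣∧<⇒2*≤ : ∀ {m n} → m ∣ n → m < n → 2 * m ≤ n
∣∧<⇒2*≤ {m} {n} m∣n m<n = begin
  2 * m              ≤⟨ *-monoˡ-≤ m (quotient>1 m∣n m<n) ⟩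
  quotient m∣n * m   ≡⟨ sym (m∣n⇒n≡quotient*m m∣n) ⟩
  n                  ∎
  where open ≤-Reasoning

prime∣¬prime⇒2*≤ : ∀ {q n} .{{_ : NonZero n}} → Prime q → ¬ Prime n → q ∣ n → 2 * q ≤ n
prime∣¬prime⇒2*≤ {q} {n} pq ¬pn q∣n = ∣∧<⇒2*≤ q∣n (≤∧≢⇒< (∣⇒≤ q∣n) q≢n)
  where
  q≢n : q ≢ n
  q≢n refl = ¬pn pq

mainTheorem6 : (k p : ℕ) → 3 ≤ k → Odd k → Prime p → k < p → φ² k p < p
mainTheorem6 k p 3≤k odd-k pp k<p = begin-strict
  φ k (φ k p)                 ≡⟨ cong (φ k) (φ-prime k pp) ⟩
  φ k (p + k)                 ≡⟨ φ-¬prime k ¬prime-p+k ⟩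
  largestPrimeDivisor (p + k) <⟨ largestPrimeDivisorFrom-< (p + k) (p + k) 1<p divisor-< ⟩
  p                           ∎
  where
  open ≤-Reasoning
  2<p : 2 < p
  2<p = <-trans 3≤k k<p
  1<p : 1 < p
  1<p = <-trans (s≤s (s≤s z≤n)) 2<p
  2<p+k : 2 < p + k
  2<p+k = <-≤-trans 2<p (m≤m+n p k)
  ¬prime-p+k : ¬ Prime (p + k)
  ¬prime-p+k = 2∣∧2<⇒¬prime (odd+odd-even (prime∧2<⇒odd pp 2<p) odd-k) 2<p+k
  divisor-< : ∀ {q} → Prime q → q ∣ p + k → q < p
  divisor-< {q} pq q∣p+k = *-cancelˡ-< 2 q p (begin-strict
    2 * q   ≤⟨ prime∣¬prime⇒2*≤ {{>-nonZero (<-trans (s≤s z≤n) 2<p+k)}} pq ¬prime-p+k q∣p+k ⟩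
    p + k   <⟨ +-monoʳ-< p k<p ⟩
    p + p   ≡⟨ cong (p +_) (sym (+-identityʳ p)) ⟩
    2 * p   ∎)
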